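{- If $G$ is a graph and $t\geq 2$, then $\iota(S_G^t) \geq \iota(S_G^2|Ex(S_G^2))\cdot n(G)^{t-2}$.
   Context: All graphs are finite and simple, $n(G)=|V(G)|$. For a graph $G=(V,E)$ and integer $t\ge1$, the generalized Sierpiński graph $S_G^t$ has vertex set $V^t$ (words $u_1\ldots u_t$), and $u=u_1\ldots u_t$, $v=v_1\ldots v_t$ are adjacent iff there is $i\in[t]$ with $u_j=v_j$ for $j<i$, $u_i\ne v_i$ and $u_iv_i\in E$, and $u_j=v_i$, $v_j=u_i$ for all $j>i$. The vertices $xx\ldots x$ are the extreme vertices; $Ex(S_G^t)$ denotes their set. A set $A$ of vertices is isolating if no two vertices outside the closed neighborhood $N[A]$ are adjacent; $\iota$ is the minimum size of an isolating set. For a graph $F$ and $X\subseteq V(F)$, $F|X$ denotes $F$ with the vertices of $X$ considered already dominated: $\iota(F|X)$ is the minimum size of a set $D\subseteq V(F)$ such that no two vertices of $V(F)-(N[D]\cup X)$ are adjacent. -}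

module Defs where

open import Data.Nat using (ℕ; _<_)
open import Data.Fin using (Fin; toℕ)
open import Data.Vec using (Vec; lookup; replicate)
open import Data.List using (List; length)
open import Data.List.Membership.Propositional using (_∈_)
open import Data.List.Relation.Unary.Unique.Propositional using (Unique)
open import Data.Product using (Σ; ∃; _×_)
open import Data.Sum using (_⊎_)
open import Relation.Nullary using (¬_)
open import Relation.Binary.PropositionalEquality using (_≡_; _≢_)

record Graph : Set₁ where
  field
    n     : ℕ
    Adj   : Fin n → Fin n → Set
    irrefl : ∀ {x} → ¬ Adj x x
    sym   : ∀ {x y} → Adj x y → Adj y x
open Graph public

-- Adjacency of the generalized Sierpinski graph S_G^t on words Vec (Fin n) t.
SAdj : (G : Graph) (t : ℕ) → Vec (Fin (n G)) t → Vec (Fin (n G)) t → Set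
SAdj G t u v = Σ (Fin t) λ i →
    (∀ (j : Fin t) → toℕ j < toℕ i → lookup u j ≡ lookup v j)
  × lookup u i ≢ lookup v i
  × Adj G (lookup u i) (lookup v i)
  × (∀ (j : Fin t) → toℕ i < toℕ j →
       (lookup u j ≡ lookup v i) × (lookup v j ≡ lookup u i))

Extreme : (G : Graph) (t : ℕ) → Vec (Fin (n G)) t → Set
Extreme G t v = ∃ λ (x : Fin (n G)) → v ≡ replicate t x

InClosedNbhd : {V : Set} (Adj : V → V → Set) (D : List V) → V → Set
InClosedNbhd Adj D v = ∃ λ d → d ∈ D × (d ≡ v ⊎ Adj d v)

IsolatingRel : {V : Set} (Adj : V → V → Set) (X : V → Set) (D : List V) → Set
IsolatingRel Adj X D = ∀ u v → Adj u v →
  ¬ ((¬ InClosedNbhd Adj D u × ¬ X u) × (¬ InClosedNbhd Adj D v × ¬ X v))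

-- ι(F|X) = k : k is the minimum size of an isolating set of F|X
-- (sets represented as duplicate-free lists).
IsIota : {V : Set} (Adj : V → V → Set) (X : V → Set) (k : ℕ) → Set
IsIota Adj X k =
    (∃ λ D → Unique D × IsolatingRel Adj X D × length D ≡ k)
  × (∀ D → Unique D → IsolatingRel Adj X D → k Data.Nat.≤ length D)

-- S_G^(t+1) consists of n(G) copies x·S_G^t of S_G^t, and an edge of S_G^(t+1)
-- leaves its copy only at a vertex x·(yy…y) whose tail is constant. So if A
-- isolates S_G^(t+1) up to the words ending in a repeated letter, then for every
-- letter x the slice {w | xw ∈ A} isolates S_G^t up to such words. Summing over the
-- n(G) disjoint slices and inducting down to t = 2, where "ending in a repeated
-- letter" means "extreme", gives the bound.
module Submission where

open import Defs
open import Data.Empty using (⊥)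
open import Data.Fin using (Fin; zero; suc; toℕ)
open import Data.Fin.Properties using (_≟_; suc-injective)
open import Data.List using (List; []; _∷_; length)
open import Data.List.Membership.Propositional using (_∈_)
import Data.List.Relation.Unary.All as All
open import Data.List.Relation.Unary.AllPairs using ([]; _∷_)
open import Data.List.Relation.Unary.Any using (here; there)
open import Data.List.Relation.Unary.Unique.Propositional using (Unique)
open import Data.Nat using (ℕ; zero; suc; _+_; _*_; _^_; _∸_; _≤_; _<_; z≤n; s≤s)
open import Data.Nat.Properties
  using (+-0-monoid; *-commutativeSemigroup; *-identityʳ; +-suc; +-mono-≤; ≤-trans; ≤-reflexive; module ≤-Reasoning)
open import Algebra.Properties.CommutativeSemigroup *-commutativeSemigroup using (x∙yz≈y∙xz)
open import Algebra.Properties.Monoid.Sum +-0-monoid using (sum; sum-cong-≗; sum-replicate-zero)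
open import Data.Product using (∃; _×_; _,_; proj₂)
open import Data.Sum using (inj₁; inj₂)
open import Data.Vec using (Vec; []; _∷_; lookup)
open import Function using (_∘_)
open import Relation.Binary.Definitions using (DecidableEquality)
open import Relation.Binary.PropositionalEquality using (_≡_; _≢_; refl; cong; cong₂; trans)
  renaming (sym to ≡-sym)
open import Relation.Nullary using (¬_; yes; no; contradiction)

module Slice {A : Set} (_≟ᴬ_ : DecidableEquality A) where

  slice : ∀ {t} → A → List (Vec A (suc t)) → List (Vec A t)
  slice x [] = []
  slice x ((y ∷ w) ∷ W) with x ≟ᴬ y
  ... | yes _ = w ∷ slice x W
  ... | no  _ = slice x W

  ∈-slice⁺ : ∀ {t x} {w : Vec A t} W → (x ∷ w) ∈ W → w ∈ slice x W
  ∈-slice⁺ {x = x} ((y ∷ _) ∷ W) (here refl) with x ≟ᴬ y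
  ... | yes _  = here refl
  ... | no x≢x = contradiction refl x≢x
  ∈-slice⁺ {x = x} ((y ∷ _) ∷ W) (there w∈W) with x ≟ᴬ y
  ... | yes _ = there (∈-slice⁺ W w∈W)
  ... | no  _ = ∈-slice⁺ W w∈W

  ∈-slice⁻ : ∀ {t x} {w : Vec A t} W → w ∈ slice x W → (x ∷ w) ∈ W
  ∈-slice⁻ {x = x} ((y ∷ _) ∷ W) w∈ with x ≟ᴬ y | w∈
  ... | yes refl | here refl = here refl
  ... | yes refl | there w∈′ = there (∈-slice⁻ W w∈′)
  ... | no  _    | w∈′       = there (∈-slice⁻ W w∈′)

  slice-unique : ∀ {t} x {W : List (Vec A (suc t))} → Unique W → Unique (slice x W)
  slice-unique x {[]} [] = []
  slice-unique x {(y ∷ w) ∷ W} (w∉W ∷ uW) with x ≟ᴬ y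
  ... | yes refl = All.tabulate (λ w′∈ w≡w′ → All.lookup w∉W (∈-slice⁻ W w′∈) (cong (x ∷_) w≡w′))
                   ∷ slice-unique x uW
  ... | no  _    = slice-unique x uW

  slice-∷-≡ : ∀ {t} y {w : Vec A t} W → slice y ((y ∷ w) ∷ W) ≡ w ∷ slice y W
  slice-∷-≡ y W with y ≟ᴬ y
  ... | yes _  = refl
  ... | no y≢y = contradiction refl y≢y

  slice-∷-≢ : ∀ {t x y} {w : Vec A t} W → x ≢ y → slice x ((y ∷ w) ∷ W) ≡ slice x W
  slice-∷-≢ {x = x} {y} W x≢y with x ≟ᴬ y
  ... | yes x≡y = contradiction x≡y x≢y
  ... | no  _   = refl

sum-suc-at : ∀ {m} (y : Fin m) {f g : Fin m → ℕ} →
  f y ≡ suc (g y) → (∀ x → x ≢ y → f x ≡ g x) → sum f ≡ suc (sum g)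
sum-suc-at zero    fy≡ f≡g = cong₂ _+_ fy≡ (sum-cong-≗ (λ x → f≡g (suc x) λ ()))
sum-suc-at (suc y) {f} {g} fy≡ f≡g =
  trans (cong₂ _+_ (f≡g zero λ ()) (sum-suc-at y fy≡ (λ x x≢y → f≡g (suc x) (x≢y ∘ suc-injective))))
        (+-suc (g zero) (sum (g ∘ suc)))

*≤sum : ∀ {m c} (f : Fin m → ℕ) → (∀ x → c ≤ f x) → m * c ≤ sum f
*≤sum {zero}  f c≤f = z≤n
*≤sum {suc m} f c≤f = +-mono-≤ (c≤f zero) (*≤sum (f ∘ suc) (c≤f ∘ suc))

module _ {n : ℕ} where

  open Slice (_≟_ {n})

  sum-length-slice : ∀ {t} (W : List (Vec (Fin n) (suc t))) → sum (λ x → length (slice x W)) ≡ length W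
  sum-length-slice [] = sum-replicate-zero n
  sum-length-slice ((y ∷ w) ∷ W) = trans
    (sum-suc-at y (cong length (slice-∷-≡ y W)) (λ x x≢y → cong length (slice-∷-≢ W x≢y)))
    (cong suc (sum-length-slice W))

IsolatingRel-mono : ∀ {V : Set} {Adj : V → V → Set} {X Y : V → Set} {D : List V} →
  (∀ {v} → X v → Y v) → IsolatingRel Adj X D → IsolatingRel Adj Y D
IsolatingRel-mono X⊆Y iso u v u~v ((u∉ , ¬Yu) , (v∉ , ¬Yv)) =
  iso u v u~v ((u∉ , ¬Yu ∘ X⊆Y) , (v∉ , ¬Yv ∘ X⊆Y))

Constant : ∀ {A : Set} {t} → Vec A t → Set
Constant u = ∃ λ c → ∀ j → lookup u j ≡ c

EndsInRepeat : ∀ {A : Set} {m} → Vec A (suc (suc m)) → Set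
EndsInRepeat {m = zero}  (a ∷ b ∷ []) = a ≡ b
EndsInRepeat {m = suc m} (_ ∷ u)      = EndsInRepeat u

Constant⇒EndsInRepeat : ∀ {A : Set} {m} (u : Vec A (suc (suc m))) → Constant u → EndsInRepeat u
Constant⇒EndsInRepeat {m = zero}  (a ∷ b ∷ []) (c , u≡c) = trans (u≡c zero) (≡-sym (u≡c (suc zero)))
Constant⇒EndsInRepeat {m = suc m} (_ ∷ u)      (c , u≡c) = Constant⇒EndsInRepeat u (c , u≡c ∘ suc)

module _ (G : Graph) where

  open Slice (_≟_ {n G})

  Word : ℕ → Set
  Word = Vec (Fin (n G))

  EndsInRepeat⇒Extreme : (u : Word 2) → EndsInRepeat u → Extreme G 2 u
  EndsInRepeat⇒Extreme (a ∷ .a ∷ []) refl = a , refl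

  SAdj-∷⁺ : ∀ {t} x {u v : Word t} → SAdj G t u v → SAdj G (suc t) (x ∷ u) (x ∷ v)
  SAdj-∷⁺ x (i , before , u≢v , u~v , after) = suc i , before′ , u≢v , u~v , after′
    where
    before′ : ∀ j → toℕ j < suc (toℕ i) → _
    before′ zero    _       = refl
    before′ (suc j) (s≤s p) = before j p
    after′ : ∀ j → suc (toℕ i) < toℕ j → _
    after′ (suc j) (s≤s p) = after j p

  -- An edge at the first letter would force its other end to have a constant tail.
  SAdj-∷⁻ : ∀ {t x y} {w u : Word t} → ¬ Constant u →
    SAdj G (suc t) (y ∷ w) (x ∷ u) → y ≡ x × SAdj G t w u
  SAdj-∷⁻ ¬const (zero , _ , _ , _ , after) =
    contradiction (_ , λ j → proj₂ (after (suc j) (s≤s z≤n))) ¬const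
  SAdj-∷⁻ ¬const (suc i , before , w≢u , w~u , after) =
    before zero (s≤s z≤n) , i , (λ j p → before (suc j) (s≤s p)) , w≢u , w~u , (λ j p → after (suc j) (s≤s p))

  InClosedNbhd-slice : ∀ {t x} {u : Word t} A → ¬ Constant u →
    InClosedNbhd (SAdj G (suc t)) A (x ∷ u) → InClosedNbhd (SAdj G t) (slice x A) u
  InClosedNbhd-slice A ¬const (_ , d∈A , inj₁ refl) = _ , ∈-slice⁺ A d∈A , inj₁ refl
  InClosedNbhd-slice A ¬const ((y ∷ w) , d∈A , inj₂ d~xu) with SAdj-∷⁻ ¬const d~xu
  ... | refl , w~u = w , ∈-slice⁺ A d∈A , inj₂ w~u

  isolating-slice : ∀ {m} x {A : List (Word (3 + m))} →
    IsolatingRel (SAdj G (3 + m)) EndsInRepeat A → IsolatingRel (SAdj G (2 + m)) EndsInRepeat (slice x A)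
  isolating-slice x {A} iso u v u~v ((u∉ , ¬ru) , (v∉ , ¬rv)) =
    iso (x ∷ u) (x ∷ v) (SAdj-∷⁺ x u~v) ((u∉ ∘ lower u ¬ru , ¬ru) , (v∉ ∘ lower v ¬rv , ¬rv))
    where
    lower : ∀ w → ¬ EndsInRepeat w → InClosedNbhd (SAdj G _) A (x ∷ w) → InClosedNbhd (SAdj G _) (slice x A) w
    lower w ¬r = InClosedNbhd-slice A (¬r ∘ Constant⇒EndsInRepeat w)

  length-isolating-≥ : ∀ {k} → IsIota (SAdj G 2) (Extreme G 2) k →
    ∀ m (A : List (Word (2 + m))) → Unique A → IsolatingRel (SAdj G (2 + m)) EndsInRepeat A →
    k * n G ^ m ≤ length A
  length-isolating-≥ {k} ι₂ zero A uA iso =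
    ≤-trans (≤-reflexive (*-identityʳ k)) (proj₂ ι₂ A uA (IsolatingRel-mono (EndsInRepeat⇒Extreme _) iso))
  length-isolating-≥ {k} ι₂ (suc m) A uA iso = begin
    k * (n G * n G ^ m)             ≡⟨ x∙yz≈y∙xz k (n G) (n G ^ m) ⟩
    n G * (k * n G ^ m)             ≤⟨ *≤sum _ (λ x → length-isolating-≥ ι₂ m (slice x A) (slice-unique x uA) (isolating-slice x iso)) ⟩
    sum (λ x → length (slice x A))  ≡⟨ sum-length-slice A ⟩
    length A                        ∎
    where open ≤-Reasoning

theorem5p3 : (G : Graph) (t : ℕ) → 2 ≤ t →
    (k : ℕ) → IsIota (SAdj G 2) (Extreme G 2) k →
    ∀ A → Unique A → IsolatingRel (SAdj G t) (λ _ → ⊥) A →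
    k * n G ^ (t ∸ 2) ≤ length A
theorem5p3 G (suc (suc m)) (s≤s (s≤s z≤n)) k ι₂ A uA iso = length-isolating-≥ G ι₂ m A uA (IsolatingRel-mono (λ ()) iso)
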